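{- Let $w=x_1\cdots x_l$ ($l\ge1$) be a word over $\mathcal{G}$ and let $Q(w)=(Q_1,\dots,Q_l)$, where $Q_i$ is the shape (Young diagram) of the tableau $P(x_1\cdots x_i)$. Then $Q(w)$ is an oscillating tableau of type $G_2$, i.e. each $Q_i$ is a Young diagram all of whose columns have height $1$ or $2$, and for each $k=1,\dots,l-1$ one of the following holds: (1) $Q_{k+1}$ is obtained by adding one box to $Q_k$; (2) $Q_{k+1}$ is obtained by deleting one box in $Q_k$; (3) $Q_{k+1}=Q_k$; (4) $Q_{k+1}$ is obtained from $Q_k$ by moving one box from height $2$ to height $1$ (i.e. from the second row to the first row); (5) $Q_{k+1}$ is obtained from $Q_k$ by moving one box from height $1$ to height $2$.
   Context: Let $\mathcal{G}=\{1,2,3,0,\bar3,\bar2,\bar1\}$, totally ordered by $1\prec2\prec3\prec0\prec\bar3\prec\bar2\prec\bar1$. $B(\Lambda_1)$ is the $U_q(G_2)$-crystal with vertices $\mathcal{G}$ and arrows $1\xrightarrow{1}2\xrightarrow{2}3\xrightarrow{1}0\xrightarrow{1}\bar3\xrightarrow{2}\bar2\xrightarrow{1}\bar1$ ($a\xrightarrow{i}b$ means $\tilde f_ia=b$, $\tilde e_ib=a$; other applications give $0$); $\varepsilon_i(u)=\max\{k:\tilde e_i^ku\ne0\}$, $\varphi_i(u)=\max\{k:\tilde f_i^ku\ne0\}$. Words over $\mathcal{G}$ are identified with vertices of $\Gamma=\bigoplus_{l\ge0}B(\Lambda_1)^{\otimes l}$, with $\tilde f_i(u\otimes v)=\tilde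 f_iu\otimes v$ if $\varphi_i(u)>\varepsilon_i(v)$, else $u\otimes\tilde f_iv$; $\tilde e_i(u\otimes v)=u\otimes\tilde e_iv$ if $\varphi_i(u)<\varepsilon_i(v)$, else $\tilde e_iu\otimes v$. $B(w)$ is the connected component of $\Gamma$ containing $w$; $w_1\sim w_2$ means there is a crystal isomorphism $B(w_1)\to B(w_2)$ sending $w_1$ to $w_2$. Tableaux of type $G_2$: $\mathrm{dist}(a,b)$ is the number of arrows between $a$ and $b$ in the chain above. A column is a box $[a]$ or two boxes with top $a$, bottom $b$, $a\prec b$ or $a=b=0$; reading $\mathrm{w}(C)$ top to bottom. Height-1 columns are admissible; a height-2 column $(a,b)$ is admissible if $\mathrm{dist}(a,b)\le2$ for $a\in\{1,0\}$ and $\le3$ otherwise. For admissible columns, $C_1\preceq C_2$ means: (i) $[a],[b]$ with $a\preceq b$, $(a,b)\ne(0,0)$; or (ii) $C_1=(a,b)$, $C_2=[c]$ with $a\preceq c$, $(a,c)\ne(0,0)$; or (iii) $C_1=(a,b)$, $C_2=(c,d)$ with $a\preceq c$, $(a,c)\neq(0,0)$, $b\preceq d$, $(b,d)\ne(0,0)$, and $\mathrm{dist}(a,d)\ge3$ if $a\in\{2,3,0\}$, $\mathrm{dist}(a,d)\ge2$ if $a=\bar3$. For $\lambda=\lambda_1\Lambda_1+\lambda_2\Lambda_2$, $Y(\lambda)$ has $\lambda_2$ columns of height 2 followed by $\lambda_1$ columns of height 1; a tableau of type $G_2$ of shape $\lambda$ is a filling $T=C_1\cdots C_s$ of $Y(\lambda)$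 with admissible columns and $C_i\preceq C_{i+1}$; reading $\mathrm{w}(T)=\mathrm{w}(C_s)\cdots\mathrm{w}(C_1)$; the shape of $T$ is $Y(\lambda)$ (the empty tableau has empty shape). By Kang–Misra, for every word $w$ there is a unique tableau of type $G_2$, $P(w)$, with $w\sim\mathrm{w}(P(w))$. -}

module Defs where

open import Data.Nat using (ℕ; zero; suc; _+_; _*_; _∸_; _≤_; _<_; _<ᵇ_)
open import Data.Bool using (Bool; true; false; if_then_else_; _∧_; _∨_; not; T)
open import Data.Maybe using (Maybe; just; nothing)
import Data.Maybe as Maybe
open import Data.List using (List; []; _∷_; length; reverse; concatMap; take)
open import Data.Vec using (Vec; []; _∷_; fromList; toList)
open import Data.Product using (Σ; ∃; _×_; _,_)
open import Data.Sum using (_⊎_)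
open import Data.List.Relation.Unary.All using (All)
open import Data.List.Relation.Unary.Linked using (Linked)
open import Relation.Binary.PropositionalEquality using (_≡_)
open import Relation.Binary.Construct.Closure.ReflexiveTransitive using (Star)

data G : Set where
  g1 g2 g3 g0 g3b g2b g1b : G

data I : Set where
  i1 i2 : I

-- position in the total order 1 ≺ 2 ≺ 3 ≺ 0 ≺ 3̄ ≺ 2̄ ≺ 1̄ (also the
-- position in the arrow chain of B(Λ₁), so dist = |rank a - rank b|)
rank : G → ℕ
rank g1  = 0
rank g2  = 1
rank g3  = 2
rank g0  = 3
rank g3b = 4
rank g2b = 5
rank g1b = 6

-- The crystal B(Λ₁):  1 -1-> 2 -2-> 3 -1-> 0 -1-> 3̄ -2-> 2̄ -1-> 1̄

fL : I → G → Maybe G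
fL i1 g1  = just g2
fL i2 g2  = just g3
fL i1 g3  = just g0
fL i1 g0  = just g3b
fL i2 g3b = just g2b
fL i1 g2b = just g1b
fL _  _   = nothing

eL : I → G → Maybe G
eL i1 g2  = just g1
eL i2 g3  = just g2
eL i1 g0  = just g3
eL i1 g3b = just g0
eL i2 g2b = just g3b
eL i1 g1b = just g2b
eL _  _   = nothing

count : {A : Set} → (A → Maybe A) → ℕ → A → ℕ
count op zero    a = zero
count op (suc n) a with op a
... | nothing = zero
... | just b  = suc (count op n b)

-- ε_i, φ_i on B(Λ₁): max k with ẽ_i^k u ≠ 0 (resp. f̃_i^k u ≠ 0);
-- the fuel 7 exceeds every chain length in B(Λ₁).
εL φL : I → G → ℕ
εL i = count (eL i) 7
φL i = count (fL i) 7

-- Words of length n = vertices of B(Λ₁)^{⊗ n}; x ∷ v is x ⊗ v.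
-- ε_i on B(Λ₁)^{⊗ n} is max k with ẽ_i^k v ≠ 0; the fuel 3n+1
-- exceeds the true value (which is at most 2n).

eV : (n : ℕ) → I → Vec G n → Maybe (Vec G n)
eV zero    i []      = nothing
eV (suc n) i (x ∷ v) =
  if φL i x <ᵇ count (eV n i) (suc (3 * n)) v
  then Maybe.map (x ∷_) (eV n i v)
  else Maybe.map (_∷ v) (eL i x)

εV : (n : ℕ) → I → Vec G n → ℕ
εV n i = count (eV n i) (suc (3 * n))

fV : (n : ℕ) → I → Vec G n → Maybe (Vec G n)
fV zero    i []      = nothing
fV (suc n) i (x ∷ v) =
  if εV n i v <ᵇ φL i x
  then Maybe.map (_∷ v) (fL i x)
  else Maybe.map (x ∷_) (fV n i v)

-- Γ = ⊕_l B(Λ₁)^{⊗ l}: vertices are words (lists) over 𝒢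

Word : Set
Word = List G

ẽ f̃ : I → Word → Maybe Word
ẽ i w = Maybe.map toList (eV (length w) i (fromList w))
f̃ i w = Maybe.map toList (fV (length w) i (fromList w))

Step : Word → Word → Set
Step u v = ∃ λ (i : I) → (f̃ i u ≡ just v) ⊎ (ẽ i u ≡ just v)

_∈B_ : Word → Word → Set
u ∈B w = Star Step w u

_∼_ : Word → Word → Set
w₁ ∼ w₂ = Σ (Word → Word) λ F →
    (F w₁ ≡ w₂)
  × (∀ u → u ∈B w₁ → F u ∈B w₂)
  × (∀ u → u ∈B w₁ → ∀ i → Maybe.map F (f̃ i u) ≡ f̃ i (F u))
  × (∀ u → u ∈B w₁ → ∀ i → Maybe.map F (ẽ i u) ≡ ẽ i (F u))
  × (∀ u u' → u ∈B w₁ → u' ∈B w₁ → F u ≡ F u' → u ≡ u')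
  × (∀ v → v ∈B w₂ → ∃ λ u → u ∈B w₁ × F u ≡ v)

data Column : Set where
  col1 : G → Column
  col2 : G → G → Column      -- top a, bottom b

isZero : G → Bool
isZero g0 = true
isZero _  = false

_≺ᵇ_ _⪯ᵇ_ : G → G → Bool
a ≺ᵇ b = rank a <ᵇ rank b
a ⪯ᵇ b = rank a <ᵇ suc (rank b)

dist : G → G → ℕ
dist a b = (rank a ∸ rank b) + (rank b ∸ rank a)

_≤ᵇ_ : ℕ → ℕ → Bool
m ≤ᵇ n = m <ᵇ suc n

notBoth0 : G → G → Bool
notBoth0 a b = not (isZero a ∧ isZero b)

maxDist : G → ℕ
maxDist g1 = 2
maxDist g0 = 2
maxDist _  = 3

admissibleᵇ : Column → Bool
admissibleᵇ (col1 a)   = true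
admissibleᵇ (col2 a b) =
  ((a ≺ᵇ b) ∨ (isZero a ∧ isZero b)) ∧ (dist a b ≤ᵇ maxDist a)

Admissible : Column → Set
Admissible C = T (admissibleᵇ C)

distCond : G → G → Bool
distCond g2  d = 3 ≤ᵇ dist g2 d
distCond g3  d = 3 ≤ᵇ dist g3 d
distCond g0  d = 3 ≤ᵇ dist g0 d
distCond g3b d = 2 ≤ᵇ dist g3b d
distCond _   _ = true

colLeqᵇ : Column → Column → Bool
colLeqᵇ (col1 a)   (col1 b)   = (a ⪯ᵇ b) ∧ notBoth0 a b
colLeqᵇ (col2 a b) (col1 c)   = (a ⪯ᵇ c) ∧ notBoth0 a c
colLeqᵇ (col2 a b) (col2 c d) =
  (a ⪯ᵇ c) ∧ notBoth0 a c ∧ (b ⪯ᵇ d) ∧ notBoth0 b d ∧ distCond a d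
colLeqᵇ (col1 _)   (col2 _ _) = false

_⪯C_ : Column → Column → Set
C₁ ⪯C C₂ = T (colLeqᵇ C₁ C₂)

Tableau : Set
Tableau = List Column

IsTableau : Tableau → Set
IsTableau t = All Admissible t × Linked _⪯C_ t

colWord : Column → Word
colWord (col1 a)   = a ∷ []
colWord (col2 a b) = a ∷ b ∷ []

readWord : Tableau → Word
readWord t = concatMap colWord (reverse t)

-- Young diagrams with at most two rows, given by row lengths (r₁ , r₂)

Diagram : Set
Diagram = ℕ × ℕ

height2 : Column → ℕ
height2 (col1 _)   = 0
height2 (col2 _ _) = 1

shape : Tableau → Diagram
shape []      = 0 , 0
shape (C ∷ t) with shape t
... | r₁ , r₂ = suc r₁ , height2 C + r₂

IsYoungDiagram : Diagram → Set
IsYoungDiagram (r₁ , r₂) = r₂ ≤ r₁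

OscStep : Diagram → Diagram → Set
OscStep (r₁ , r₂) (s₁ , s₂) =
    ((s₁ ≡ suc r₁ × s₂ ≡ r₂) ⊎ (s₁ ≡ r₁ × s₂ ≡ suc r₂))
  ⊎ ((r₁ ≡ suc s₁ × r₂ ≡ s₂) ⊎ (r₁ ≡ s₁ × r₂ ≡ suc s₂))
  ⊎ (s₁ ≡ r₁ × s₂ ≡ r₂)
  ⊎ (r₂ ≡ suc s₂ × s₁ ≡ suc r₁)
  ⊎ (s₂ ≡ suc r₂ × r₁ ≡ suc s₁)

-- (Q₁ , … , Q_l) given as Q : ℕ → Diagram, with Q k = Q_{k+1}
IsOscillatingTableau : ℕ → (ℕ → Diagram) → Set
IsOscillatingTableau l Q =
    (∀ k → k < l → IsYoungDiagram (Q k))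
  × (∀ k → suc k < l → OscStep (Q k) (Q (suc k)))

{-# OPTIONS --safe #-}

-- Let u = x₁ ⋯ x_k and x = x_{k+1}. By the tensor product rule, a highest-weight vertex of
-- B(u x) has the form h₀ ⊗ y with h₀ a highest-weight vertex of B(u) and ε_i(y) ≤ φ_i(h₀).
-- Reading words of G₂ tableaux are closed under ẽ_i and f̃_i, which change one column at a
-- time and preserve the shape; and a tableau with highest-weight reading word has shape
-- Y(φ₁ Λ₁ + φ₂ Λ₂). Transporting along the isomorphisms B(u) ≅ B(w(P(u))), the shapes of
-- P(u) and P(u x) are therefore the diagrams of the dominant weights φ(h₀) and
-- φ(h₀ ⊗ y) = φ(h₀) + wt(y). The seven weights ±Λ₁, ±(Λ₂ − Λ₁), ±(2Λ₁ − Λ₂), 0 of B(Λ₁)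
-- give exactly the five moves of an oscillating tableau.

module Submission where

open import Data.Bool using (Bool; true; false; if_then_else_; T; not; _∧_; _∨_)
open import Data.Bool.ListAction using (all)
open import Data.Bool.Properties using (T-∧)
open import Data.Empty using (⊥-elim)
open import Data.Fin using (fromℕ<)
open import Data.Fin.Properties using (toℕ-fromℕ<)
open import Data.List using (List; []; _∷_; _++_; [_]; length; map; reverse; concatMap; lookup; take)
import Data.List.Properties as Listₚ
open import Data.List.Membership.Propositional using (_∈_)
open import Data.List.Relation.Unary.All using (All; []; _∷_)
import Data.List.Relation.Unary.All as All
open import Data.List.Relation.Unary.All.Properties using (all⁺)
open import Data.List.Relation.Unary.Any using (here; there)
open import Data.List.Relation.Unary.Linked using (Linked; [-]; _∷_)
import Data.List.Relation.Unary.Linked as Linked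
open import Data.Maybe using (Maybe; just; nothing; maybe′)
import Data.Maybe as Maybe
import Data.Maybe.Properties as Maybeₚ
open import Data.Nat hiding (_≤ᵇ_)
open import Data.Nat.Induction using (<-wellFounded)
open import Data.Nat.ListAction using (sum)
open import Data.Nat.Properties
open import Data.Product using (∃; ∃₂; _×_; _,_; proj₁; proj₂)
open import Data.Sum using (_⊎_; inj₁; inj₂)
open import Data.Unit using (tt)
open import Data.Vec using (Vec; []; _∷_; toList; fromList)
open import Data.Vec.Properties using (length-toList; toList∘fromList)
open import Function using (_∘_)
open import Function.Bundles using (Equivalence)
open import Induction.WellFounded using (Acc; acc)
open import Relation.Binary.Construct.Closure.ReflexiveTransitive using (ε; _◅_; _◅◅_)
open import Relation.Binary.PropositionalEquality hiding ([_])
open import Relation.Nullary.Decidable using (yes; no)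
open import Relation.Nullary.Reflects using (ofʸ; ofⁿ)

open import Defs

[m+n]∸o≡[m∸o]+[n∸[o∸m]] : ∀ m n o → (m + n) ∸ o ≡ (m ∸ o) + (n ∸ (o ∸ m))
[m+n]∸o≡[m∸o]+[n∸[o∸m]] m       n zero    = cong (λ k → m + (n ∸ k)) (sym (0∸n≡0 m))
[m+n]∸o≡[m∸o]+[n∸[o∸m]] zero    n (suc o) = refl
[m+n]∸o≡[m∸o]+[n∸[o∸m]] (suc m) n (suc o) = [m+n]∸o≡[m∸o]+[n∸[o∸m]] m n o

m+[n∸o]≡m : ∀ m {n o} → n ≤ o → m + (n ∸ o) ≡ m
m+[n∸o]≡m m n≤o = trans (cong (m +_) (m≤n⇒m∸n≡0 n≤o)) (+-identityʳ m)

m+[1+n∸o]≡1+[m+[n∸o]] : ∀ m {n o} → o ≤ n → m + (suc n ∸ o) ≡ suc (m + (n ∸ o))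
m+[1+n∸o]≡1+[m+[n∸o]] m o≤n = trans (cong (m +_) (+-∸-assoc 1 o≤n)) (+-suc m _)

c+[p∸a]≤b⇒p≤a+[b∸c] : ∀ a b c p → c + (p ∸ a) ≤ b → p ≤ a + (b ∸ c)
c+[p∸a]≤b⇒p≤a+[b∸c] a b c p le =
  ≤-trans (m≤n+m∸n p a) (+-monoʳ-≤ a (m+n≤o⇒m≤o∸n (p ∸ a) (subst (_≤ b) (+-comm c _) le)))

c+[p∸a]<b⇒p<a+[b∸c] : ∀ a b c p → c + (p ∸ a) < b → p < a + (b ∸ c)
c+[p∸a]<b⇒p<a+[b∸c] a b c p lt =
  ≤-<-trans (m≤n+m∸n p a) (+-monoʳ-< a (m+n≤o⇒m≤o∸n (suc (p ∸ a)) (subst (_≤ b) (cong suc (+-comm c _)) lt)))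

0<p∸a⇒a+[p∸a]≡p : ∀ a p → 0 < p ∸ a → a + (p ∸ a) ≡ p
0<p∸a⇒a+[p∸a]≡p a p pos = m+[n∸m]≡n {a} {p} (<⇒≤ (m∸n≢0⇒n<m (λ p∸a≡0 → <-irrefl (sym p∸a≡0) pos)))

c<b⇒b≤c+[p∸a]⇒a+[b∸c]≤p : ∀ a b c p → c < b → b ≤ c + (p ∸ a) → a + (b ∸ c) ≤ p
c<b⇒b≤c+[p∸a]⇒a+[b∸c]≤p a b c p c<b le = begin
  a + (b ∸ c)  ≤⟨ +-monoʳ-≤ a b∸c≤p∸a ⟩
  a + (p ∸ a)  ≡⟨ 0<p∸a⇒a+[p∸a]≡p a p (<-≤-trans (m<n⇒0<n∸m c<b) b∸c≤p∸a) ⟩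
  p            ∎
  where
  open ≤-Reasoning
  b∸c≤p∸a : b ∸ c ≤ p ∸ a
  b∸c≤p∸a = m≤n+o⇒m∸n≤o b c le

c≤b⇒b<c+[p∸a]⇒a+[b∸c]<p : ∀ a b c p → c ≤ b → b < c + (p ∸ a) → a + (b ∸ c) < p
c≤b⇒b<c+[p∸a]⇒a+[b∸c]<p a b c p c≤b lt = begin-strict
  a + (b ∸ c)  <⟨ +-monoʳ-< a b∸c<p∸a ⟩
  a + (p ∸ a)  ≡⟨ 0<p∸a⇒a+[p∸a]≡p a p (≤-<-trans z≤n b∸c<p∸a) ⟩
  p            ∎
  where
  open ≤-Reasoning
  b∸c<p∸a : b ∸ c < p ∸ a
  b∸c<p∸a = subst (b ∸ c <_) (m+n∸m≡n c (p ∸ a)) (∸-monoˡ-< lt c≤b)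

if-<ᵇ-yes : {X : Set} {m n : ℕ} {a b : X} → m < n → (if m <ᵇ n then a else b) ≡ a
if-<ᵇ-yes {m = m} {n} m<n with m <ᵇ n | <ᵇ-reflects-< m n
... | true  | _        = refl
... | false | ofⁿ m≮n = ⊥-elim (m≮n m<n)

if-<ᵇ-no : {X : Set} {m n : ℕ} {a b : X} → n ≤ m → (if m <ᵇ n then a else b) ≡ b
if-<ᵇ-no {m = m} {n} n≤m with m <ᵇ n | <ᵇ-reflects-< m n
... | true  | ofʸ m<n = ⊥-elim (<⇒≱ m<n n≤m)
... | false | _        = refl

data StringStep {B : Set} (op : B → Maybe B) (μ ν : B → ℕ) (b : B) : Set where
  end  : op b ≡ nothing → μ b ≡ 0 → StringStep op μ ν b
  step : ∀ {b'} → op b ≡ just b' → μ b ≡ suc (μ b') → ν b' ≡ suc (ν b) → StringStep op μ ν b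

count-exact : {B : Set} {op : B → Maybe B} {μ ν : B → ℕ} → (∀ b → StringStep op μ ν b) →
              ∀ fuel b → μ b < fuel → count op fuel b ≡ μ b
count-exact string (suc fuel) b μb<fuel with string b
... | end op≡nothing μb≡0 rewrite op≡nothing = sym μb≡0
... | step {b'} op≡just μb≡ _ rewrite op≡just =
  trans (cong suc (count-exact string fuel b' (≤-pred (subst (_< suc fuel) μb≡ μb<fuel)))) (sym μb≡)

module _ {B : Set} {op : B → Maybe B} {μ ν : B → ℕ} {b : B} where

  undefined⇒μ≡0 : StringStep op μ ν b → op b ≡ nothing → μ b ≡ 0
  undefined⇒μ≡0 (end _ μb≡0)        _          = μb≡0
  undefined⇒μ≡0 (step op≡just _ _) op≡nothing with () ← trans (sym op≡nothing) op≡just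

  μ≡0⇒undefined : StringStep op μ ν b → μ b ≡ 0 → op b ≡ nothing
  μ≡0⇒undefined (end op≡nothing _) _    = op≡nothing
  μ≡0⇒undefined (step _ μb≡ _)     μb≡0 with () ← trans (sym μb≡0) μb≡

StringStep-map : {B C : Set} {op : B → Maybe B} {op′ : C → Maybe C} {μ ν : C → ℕ} (h : B → C) →
                 (∀ b → Maybe.map h (op b) ≡ op′ (h b)) →
                 ∀ b → StringStep op′ μ ν (h b) → StringStep op (μ ∘ h) (ν ∘ h) b
StringStep-map {op = op} h op-h b string with op b in op≡
... | nothing = end op≡ (undefined⇒μ≡0 string (trans (sym (op-h b)) (cong (Maybe.map h) op≡)))
... | just b' with string
...   | end op′≡nothing _ with () ← trans (sym op′≡nothing) (trans (sym (op-h b)) (cong (Maybe.map h) op≡))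
...   | step op′≡just μ≡ ν≡ with refl ← trans (sym op′≡just) (trans (sym (op-h b)) (cong (Maybe.map h) op≡)) =
  step op≡ μ≡ ν≡

map≡just : {X Y : Set} {g : X → Y} (m : Maybe X) {y : Y} → Maybe.map g m ≡ just y → ∃ λ x → m ≡ just x × g x ≡ y
map≡just (just x) refl = x , refl , refl

-- The signature rule

module Signature {A : Set} (ẽᴬ f̃ᴬ : I → A → Maybe A) (εᴬ φᴬ : I → A → ℕ)
  (ẽᴬ-string : ∀ i x → StringStep (ẽᴬ i) (εᴬ i) (φᴬ i) x)
  (f̃ᴬ-string : ∀ i x → StringStep (f̃ᴬ i) (φᴬ i) (εᴬ i) x) where

  ε⊗ φ⊗ : I → List A → ℕ
  ε⊗ i []      = 0
  ε⊗ i (x ∷ v) = εᴬ i x + (ε⊗ i v ∸ φᴬ i x)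
  φ⊗ i []      = 0
  φ⊗ i (x ∷ v) = φ⊗ i v + (φᴬ i x ∸ ε⊗ i v)

  ẽ⊗ f̃⊗ : I → List A → Maybe (List A)
  ẽ⊗ i []      = nothing
  ẽ⊗ i (x ∷ v) =
    if φᴬ i x <ᵇ ε⊗ i v then Maybe.map (x ∷_) (ẽ⊗ i v) else Maybe.map (_∷ v) (ẽᴬ i x)
  f̃⊗ i []      = nothing
  f̃⊗ i (x ∷ v) =
    if ε⊗ i v <ᵇ φᴬ i x then Maybe.map (_∷ v) (f̃ᴬ i x) else Maybe.map (x ∷_) (f̃⊗ i v)

  ẽ⊗-∷ʳ : ∀ i x w → φᴬ i x < ε⊗ i w → ẽ⊗ i (x ∷ w) ≡ Maybe.map (x ∷_) (ẽ⊗ i w)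
  ẽ⊗-∷ʳ i x w = if-<ᵇ-yes

  ẽ⊗-∷ˡ : ∀ i x w → ε⊗ i w ≤ φᴬ i x → ẽ⊗ i (x ∷ w) ≡ Maybe.map (_∷ w) (ẽᴬ i x)
  ẽ⊗-∷ˡ i x w = if-<ᵇ-no

  f̃⊗-∷ˡ : ∀ i x w → ε⊗ i w < φᴬ i x → f̃⊗ i (x ∷ w) ≡ Maybe.map (_∷ w) (f̃ᴬ i x)
  f̃⊗-∷ˡ i x w = if-<ᵇ-yes

  f̃⊗-∷ʳ : ∀ i x w → φᴬ i x ≤ ε⊗ i w → f̃⊗ i (x ∷ w) ≡ Maybe.map (x ∷_) (f̃⊗ i w)
  f̃⊗-∷ʳ i x w = if-<ᵇ-no

  ẽ⊗-string : ∀ i v → StringStep (ẽ⊗ i) (ε⊗ i) (φ⊗ i) v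
  ẽ⊗-string i [] = end refl refl
  ẽ⊗-string i (x ∷ v) with φᴬ i x <? ε⊗ i v
  ... | yes φx<εv with ẽ⊗-string i v
  ...   | end _ εv≡0 = ⊥-elim (n≮0 (subst (φᴬ i x <_) εv≡0 φx<εv))
  ...   | step {v'} ẽv≡ εv≡ φv'≡ = step (trans (ẽ⊗-∷ʳ i x v φx<εv) (cong (Maybe.map (x ∷_)) ẽv≡))
    (trans (cong (λ e → εᴬ i x + (e ∸ φᴬ i x)) εv≡) (m+[1+n∸o]≡1+[m+[n∸o]] _ φx≤εv'))
    (trans (m+[n∸o]≡m _ φx≤εv') (trans φv'≡ (cong suc (sym (m+[n∸o]≡m _ (<⇒≤ φx<εv))))))
    where
    φx≤εv' : φᴬ i x ≤ ε⊗ i v'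
    φx≤εv' = ≤-pred (subst (φᴬ i x <_) εv≡ φx<εv)
  ẽ⊗-string i (x ∷ v) | no φx≮εv with ẽᴬ-string i x
  ... | end ẽx≡ εx≡0 =
    end (trans (ẽ⊗-∷ˡ i x v (≮⇒≥ φx≮εv)) (cong (Maybe.map (_∷ v)) ẽx≡)) (trans (m+[n∸o]≡m _ (≮⇒≥ φx≮εv)) εx≡0)
  ... | step {x'} ẽx≡ εx≡ φx'≡ = step (trans (ẽ⊗-∷ˡ i x v (≮⇒≥ φx≮εv)) (cong (Maybe.map (_∷ v)) ẽx≡))
    (trans (m+[n∸o]≡m _ (≮⇒≥ φx≮εv)) (trans εx≡ (cong suc (sym (m+[n∸o]≡m _ εv≤φx')))))
    (trans (cong (λ p → φ⊗ i v + (p ∸ ε⊗ i v)) φx'≡) (m+[1+n∸o]≡1+[m+[n∸o]] _ (≮⇒≥ φx≮εv)))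
    where
    εv≤φx' : ε⊗ i v ≤ φᴬ i x'
    εv≤φx' = ≤-trans (≮⇒≥ φx≮εv) (subst (φᴬ i x ≤_) (sym φx'≡) (n≤1+n _))

  f̃⊗-string : ∀ i v → StringStep (f̃⊗ i) (φ⊗ i) (ε⊗ i) v
  f̃⊗-string i [] = end refl refl
  f̃⊗-string i (x ∷ v) with ε⊗ i v <? φᴬ i x
  ... | yes εv<φx with f̃ᴬ-string i x
  ...   | end _ φx≡0 = ⊥-elim (n≮0 (subst (ε⊗ i v <_) φx≡0 εv<φx))
  ...   | step {x'} f̃x≡ φx≡ εx'≡ = step (trans (f̃⊗-∷ˡ i x v εv<φx) (cong (Maybe.map (_∷ v)) f̃x≡))
    (trans (cong (λ p → φ⊗ i v + (p ∸ ε⊗ i v)) φx≡) (m+[1+n∸o]≡1+[m+[n∸o]] _ εv≤φx'))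
    (trans (m+[n∸o]≡m _ εv≤φx') (trans εx'≡ (cong suc (sym (m+[n∸o]≡m _ (<⇒≤ εv<φx))))))
    where
    εv≤φx' : ε⊗ i v ≤ φᴬ i x'
    εv≤φx' = ≤-pred (subst (ε⊗ i v <_) φx≡ εv<φx)
  f̃⊗-string i (x ∷ v) | no εv≮φx with f̃⊗-string i v
  ... | end f̃v≡ φv≡0 =
    end (trans (f̃⊗-∷ʳ i x v (≮⇒≥ εv≮φx)) (cong (Maybe.map (x ∷_)) f̃v≡)) (trans (m+[n∸o]≡m _ (≮⇒≥ εv≮φx)) φv≡0)
  ... | step {v'} f̃v≡ φv≡ εv'≡ = step (trans (f̃⊗-∷ʳ i x v (≮⇒≥ εv≮φx)) (cong (Maybe.map (x ∷_)) f̃v≡))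
    (trans (m+[n∸o]≡m _ (≮⇒≥ εv≮φx)) (trans φv≡ (cong suc (sym (m+[n∸o]≡m _ φx≤εv')))))
    (trans (cong (λ e → εᴬ i x + (e ∸ φᴬ i x)) εv'≡) (m+[1+n∸o]≡1+[m+[n∸o]] _ (≮⇒≥ εv≮φx)))
    where
    φx≤εv' : φᴬ i x ≤ ε⊗ i v'
    φx≤εv' = ≤-trans (≮⇒≥ εv≮φx) (subst (ε⊗ i v ≤_) (sym εv'≡) (n≤1+n _))

  ε⊗-singleton : ∀ i x → ε⊗ i [ x ] ≡ εᴬ i x
  ε⊗-singleton i x = m+[n∸o]≡m (εᴬ i x) {0} {φᴬ i x} z≤n

  f̃⊗-singleton : ∀ i x → f̃⊗ i [ x ] ≡ Maybe.map [_] (f̃ᴬ i x)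
  f̃⊗-singleton i x with 0 <? φᴬ i x
  ... | yes 0<φx = f̃⊗-∷ˡ i x [] 0<φx
  ... | no 0≮φx  = trans (f̃⊗-∷ʳ i x [] (≮⇒≥ 0≮φx))
                         (cong (Maybe.map [_]) (sym (μ≡0⇒undefined (f̃ᴬ-string i x) (n≤0⇒n≡0 (≮⇒≥ 0≮φx)))))

  ε⊗-++ : ∀ i u v → ε⊗ i (u ++ v) ≡ ε⊗ i u + (ε⊗ i v ∸ φ⊗ i u)
  ε⊗-++ i []      v = refl
  ε⊗-++ i (x ∷ u) v = begin
    εᴬ i x + (ε⊗ i (u ++ v) ∸ φᴬ i x)
      ≡⟨ cong (λ e → εᴬ i x + (e ∸ φᴬ i x)) (ε⊗-++ i u v) ⟩
    εᴬ i x + ((ε⊗ i u + (ε⊗ i v ∸ φ⊗ i u)) ∸ φᴬ i x)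
      ≡⟨ cong (εᴬ i x +_) ([m+n]∸o≡[m∸o]+[n∸[o∸m]] (ε⊗ i u) _ (φᴬ i x)) ⟩
    εᴬ i x + ((ε⊗ i u ∸ φᴬ i x) + ((ε⊗ i v ∸ φ⊗ i u) ∸ (φᴬ i x ∸ ε⊗ i u)))
      ≡⟨ cong (λ d → εᴬ i x + ((ε⊗ i u ∸ φᴬ i x) + d)) (∸-+-assoc (ε⊗ i v) (φ⊗ i u) _) ⟩
    εᴬ i x + ((ε⊗ i u ∸ φᴬ i x) + (ε⊗ i v ∸ (φ⊗ i u + (φᴬ i x ∸ ε⊗ i u))))
      ≡⟨ +-assoc (εᴬ i x) _ _ ⟨
    εᴬ i x + (ε⊗ i u ∸ φᴬ i x) + (ε⊗ i v ∸ (φ⊗ i u + (φᴬ i x ∸ ε⊗ i u)))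
      ∎
    where open ≡-Reasoning

  φ⊗-++ : ∀ i u v → φ⊗ i (u ++ v) ≡ φ⊗ i v + (φ⊗ i u ∸ ε⊗ i v)
  φ⊗-++ i []      v = sym (m+[n∸o]≡m (φ⊗ i v) {0} {ε⊗ i v} z≤n)
  φ⊗-++ i (x ∷ u) v = begin
    φ⊗ i (u ++ v) + (φᴬ i x ∸ ε⊗ i (u ++ v))
      ≡⟨ cong₂ (λ f e → f + (φᴬ i x ∸ e)) (φ⊗-++ i u v) (ε⊗-++ i u v) ⟩
    φ⊗ i v + (φ⊗ i u ∸ ε⊗ i v) + (φᴬ i x ∸ (ε⊗ i u + (ε⊗ i v ∸ φ⊗ i u)))
      ≡⟨ cong (φ⊗ i v + (φ⊗ i u ∸ ε⊗ i v) +_) (∸-+-assoc (φᴬ i x) (ε⊗ i u) _) ⟨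
    φ⊗ i v + (φ⊗ i u ∸ ε⊗ i v) + ((φᴬ i x ∸ ε⊗ i u) ∸ (ε⊗ i v ∸ φ⊗ i u))
      ≡⟨ +-assoc (φ⊗ i v) _ _ ⟩
    φ⊗ i v + ((φ⊗ i u ∸ ε⊗ i v) + ((φᴬ i x ∸ ε⊗ i u) ∸ (ε⊗ i v ∸ φ⊗ i u)))
      ≡⟨ cong (φ⊗ i v +_) ([m+n]∸o≡[m∸o]+[n∸[o∸m]] (φ⊗ i u) (φᴬ i x ∸ ε⊗ i u) (ε⊗ i v)) ⟨
    φ⊗ i v + ((φ⊗ i u + (φᴬ i x ∸ ε⊗ i u)) ∸ ε⊗ i v)
      ∎
    where open ≡-Reasoning

  ε⊗-++-≤ : ∀ i u v → ε⊗ i v ≤ φ⊗ i u → ε⊗ i (u ++ v) ≡ ε⊗ i u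
  ε⊗-++-≤ i u v εv≤φu = trans (ε⊗-++ i u v) (m+[n∸o]≡m (ε⊗ i u) εv≤φu)

  φ⊗-++-≤ : ∀ i u v → φ⊗ i u ≤ ε⊗ i v → φ⊗ i (u ++ v) ≡ φ⊗ i v
  φ⊗-++-≤ i u v φu≤εv = trans (φ⊗-++ i u v) (m+[n∸o]≡m (φ⊗ i v) φu≤εv)

  φ⊗≤φ⊗-++ : ∀ i u v → φ⊗ i v ≤ φ⊗ i (u ++ v)
  φ⊗≤φ⊗-++ i u v = subst (φ⊗ i v ≤_) (sym (φ⊗-++ i u v)) (m≤m+n _ _)

  φ⊗-++-ε≡0 : ∀ i u v → ε⊗ i v ≡ 0 → φ⊗ i (u ++ v) ≡ φ⊗ i v + φ⊗ i u
  φ⊗-++-ε≡0 i u v εv≡0 = trans (φ⊗-++ i u v) (cong (λ e → φ⊗ i v + (φ⊗ i u ∸ e)) εv≡0)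

  ε⊗-++≡0 : ∀ i u v → ε⊗ i (u ++ v) ≡ 0 → ε⊗ i u ≡ 0 × ε⊗ i v ≤ φ⊗ i u
  ε⊗-++≡0 i u v ε≡0 = m+n≡0⇒m≡0 (ε⊗ i u) ε≡0′ , m∸n≡0⇒m≤n (m+n≡0⇒n≡0 (ε⊗ i u) ε≡0′)
    where
    ε≡0′ : ε⊗ i u + (ε⊗ i v ∸ φ⊗ i u) ≡ 0
    ε≡0′ = trans (sym (ε⊗-++ i u v)) ε≡0

  ẽ⊗-++ʳ : ∀ i u v → φ⊗ i u < ε⊗ i v → ẽ⊗ i (u ++ v) ≡ Maybe.map (u ++_) (ẽ⊗ i v)
  ẽ⊗-++ʳ i []      v _   = sym (Maybeₚ.map-id (ẽ⊗ i v))
  ẽ⊗-++ʳ i (x ∷ u) v φ<ε = begin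
    ẽ⊗ i (x ∷ u ++ v)                              ≡⟨ ẽ⊗-∷ʳ i x (u ++ v) φx<ε ⟩
    Maybe.map (x ∷_) (ẽ⊗ i (u ++ v))               ≡⟨ cong (Maybe.map (x ∷_)) (ẽ⊗-++ʳ i u v φu<εv) ⟩
    Maybe.map (x ∷_) (Maybe.map (u ++_) (ẽ⊗ i v))  ≡⟨ Maybeₚ.map-∘ (ẽ⊗ i v) ⟨
    Maybe.map ((x ∷ u) ++_) (ẽ⊗ i v)               ∎
    where
    open ≡-Reasoning
    φu<εv : φ⊗ i u < ε⊗ i v
    φu<εv = ≤-<-trans (m≤m+n _ _) φ<ε
    φx<ε : φᴬ i x < ε⊗ i (u ++ v)
    φx<ε = subst (φᴬ i x <_) (sym (ε⊗-++ i u v)) (c+[p∸a]<b⇒p<a+[b∸c] (ε⊗ i u) (ε⊗ i v) (φ⊗ i u) (φᴬ i x) φ<ε)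

  ẽ⊗-++ˡ : ∀ i u v → ε⊗ i v ≤ φ⊗ i u → ẽ⊗ i (u ++ v) ≡ Maybe.map (_++ v) (ẽ⊗ i u)
  ẽ⊗-++ˡ i []      v εv≤0 = μ≡0⇒undefined (ẽ⊗-string i v) (n≤0⇒n≡0 εv≤0)
  ẽ⊗-++ˡ i (x ∷ u) v ε≤φ with φ⊗ i u <? ε⊗ i v
  ... | yes φu<εv = begin
    ẽ⊗ i (x ∷ u ++ v)                               ≡⟨ ẽ⊗-∷ˡ i x (u ++ v) ε≤φx ⟩
    Maybe.map (_∷ (u ++ v)) (ẽᴬ i x)                ≡⟨ Maybeₚ.map-∘ (ẽᴬ i x) ⟩
    Maybe.map (_++ v) (Maybe.map (_∷ u) (ẽᴬ i x))   ≡⟨ cong (Maybe.map (_++ v)) (ẽ⊗-∷ˡ i x u (≤-trans (m≤m+n _ _) εu≤φx)) ⟨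
    Maybe.map (_++ v) (ẽ⊗ i (x ∷ u))                ∎
    where
    open ≡-Reasoning
    εu≤φx : ε⊗ i u + (ε⊗ i v ∸ φ⊗ i u) ≤ φᴬ i x
    εu≤φx = c<b⇒b≤c+[p∸a]⇒a+[b∸c]≤p (ε⊗ i u) (ε⊗ i v) (φ⊗ i u) (φᴬ i x) φu<εv ε≤φ
    ε≤φx : ε⊗ i (u ++ v) ≤ φᴬ i x
    ε≤φx = subst (_≤ φᴬ i x) (sym (ε⊗-++ i u v)) εu≤φx
  ... | no φu≮εv with φᴬ i x <? ε⊗ i u
  ...   | yes φx<εu = begin
    ẽ⊗ i (x ∷ u ++ v)                               ≡⟨ ẽ⊗-∷ʳ i x (u ++ v) (subst (φᴬ i x <_) (sym ε≡) φx<εu) ⟩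
    Maybe.map (x ∷_) (ẽ⊗ i (u ++ v))                ≡⟨ cong (Maybe.map (x ∷_)) (ẽ⊗-++ˡ i u v (≮⇒≥ φu≮εv)) ⟩
    Maybe.map (x ∷_) (Maybe.map (_++ v) (ẽ⊗ i u))   ≡⟨ trans (sym (Maybeₚ.map-∘ (ẽ⊗ i u))) (Maybeₚ.map-∘ (ẽ⊗ i u)) ⟩
    Maybe.map (_++ v) (Maybe.map (x ∷_) (ẽ⊗ i u))   ≡⟨ cong (Maybe.map (_++ v)) (ẽ⊗-∷ʳ i x u φx<εu) ⟨
    Maybe.map (_++ v) (ẽ⊗ i (x ∷ u))                ∎
    where
    open ≡-Reasoning
    ε≡ : ε⊗ i (u ++ v) ≡ ε⊗ i u
    ε≡ = ε⊗-++-≤ i u v (≮⇒≥ φu≮εv)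
  ...   | no φx≮εu = begin
    ẽ⊗ i (x ∷ u ++ v)                               ≡⟨ ẽ⊗-∷ˡ i x (u ++ v) (subst (_≤ φᴬ i x) (sym ε≡) (≮⇒≥ φx≮εu)) ⟩
    Maybe.map (_∷ (u ++ v)) (ẽᴬ i x)                ≡⟨ Maybeₚ.map-∘ (ẽᴬ i x) ⟩
    Maybe.map (_++ v) (Maybe.map (_∷ u) (ẽᴬ i x))   ≡⟨ cong (Maybe.map (_++ v)) (ẽ⊗-∷ˡ i x u (≮⇒≥ φx≮εu)) ⟨
    Maybe.map (_++ v) (ẽ⊗ i (x ∷ u))                ∎
    where
    open ≡-Reasoning
    ε≡ : ε⊗ i (u ++ v) ≡ ε⊗ i u
    ε≡ = ε⊗-++-≤ i u v (≮⇒≥ φu≮εv)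

  f̃⊗-++ʳ : ∀ i u v → φ⊗ i u ≤ ε⊗ i v → f̃⊗ i (u ++ v) ≡ Maybe.map (u ++_) (f̃⊗ i v)
  f̃⊗-++ʳ i []      v _   = sym (Maybeₚ.map-id (f̃⊗ i v))
  f̃⊗-++ʳ i (x ∷ u) v φ≤ε = begin
    f̃⊗ i (x ∷ u ++ v)                              ≡⟨ f̃⊗-∷ʳ i x (u ++ v) φx≤ε ⟩
    Maybe.map (x ∷_) (f̃⊗ i (u ++ v))               ≡⟨ cong (Maybe.map (x ∷_)) (f̃⊗-++ʳ i u v φu≤εv) ⟩
    Maybe.map (x ∷_) (Maybe.map (u ++_) (f̃⊗ i v))  ≡⟨ Maybeₚ.map-∘ (f̃⊗ i v) ⟨
    Maybe.map ((x ∷ u) ++_) (f̃⊗ i v)               ∎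
    where
    open ≡-Reasoning
    φu≤εv : φ⊗ i u ≤ ε⊗ i v
    φu≤εv = ≤-trans (m≤m+n _ _) φ≤ε
    φx≤ε : φᴬ i x ≤ ε⊗ i (u ++ v)
    φx≤ε = subst (φᴬ i x ≤_) (sym (ε⊗-++ i u v)) (c+[p∸a]≤b⇒p≤a+[b∸c] (ε⊗ i u) (ε⊗ i v) (φ⊗ i u) (φᴬ i x) φ≤ε)

  f̃⊗-++ˡ : ∀ i u v → ε⊗ i v < φ⊗ i u → f̃⊗ i (u ++ v) ≡ Maybe.map (_++ v) (f̃⊗ i u)
  f̃⊗-++ˡ i []      v ()
  f̃⊗-++ˡ i (x ∷ u) v ε<φ with φ⊗ i u ≤? ε⊗ i v
  ... | yes φu≤εv = begin
    f̃⊗ i (x ∷ u ++ v)                               ≡⟨ f̃⊗-∷ˡ i x (u ++ v) ε<φx ⟩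
    Maybe.map (_∷ (u ++ v)) (f̃ᴬ i x)                ≡⟨ Maybeₚ.map-∘ (f̃ᴬ i x) ⟩
    Maybe.map (_++ v) (Maybe.map (_∷ u) (f̃ᴬ i x))   ≡⟨ cong (Maybe.map (_++ v)) (f̃⊗-∷ˡ i x u (≤-<-trans (m≤m+n _ _) εu<φx)) ⟨
    Maybe.map (_++ v) (f̃⊗ i (x ∷ u))                ∎
    where
    open ≡-Reasoning
    εu<φx : ε⊗ i u + (ε⊗ i v ∸ φ⊗ i u) < φᴬ i x
    εu<φx = c≤b⇒b<c+[p∸a]⇒a+[b∸c]<p (ε⊗ i u) (ε⊗ i v) (φ⊗ i u) (φᴬ i x) φu≤εv ε<φ
    ε<φx : ε⊗ i (u ++ v) < φᴬ i x
    ε<φx = subst (_< φᴬ i x) (sym (ε⊗-++ i u v)) εu<φx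
  ... | no φu≰εv with ε⊗ i u <? φᴬ i x
  ...   | yes εu<φx = begin
    f̃⊗ i (x ∷ u ++ v)                               ≡⟨ f̃⊗-∷ˡ i x (u ++ v) (subst (_< φᴬ i x) (sym ε≡) εu<φx) ⟩
    Maybe.map (_∷ (u ++ v)) (f̃ᴬ i x)                ≡⟨ Maybeₚ.map-∘ (f̃ᴬ i x) ⟩
    Maybe.map (_++ v) (Maybe.map (_∷ u) (f̃ᴬ i x))   ≡⟨ cong (Maybe.map (_++ v)) (f̃⊗-∷ˡ i x u εu<φx) ⟨
    Maybe.map (_++ v) (f̃⊗ i (x ∷ u))                ∎
    where
    open ≡-Reasoning
    ε≡ : ε⊗ i (u ++ v) ≡ ε⊗ i u
    ε≡ = ε⊗-++-≤ i u v (<⇒≤ (≰⇒> φu≰εv))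
  ...   | no εu≮φx = begin
    f̃⊗ i (x ∷ u ++ v)                               ≡⟨ f̃⊗-∷ʳ i x (u ++ v) (subst (φᴬ i x ≤_) (sym ε≡) (≮⇒≥ εu≮φx)) ⟩
    Maybe.map (x ∷_) (f̃⊗ i (u ++ v))                ≡⟨ cong (Maybe.map (x ∷_)) (f̃⊗-++ˡ i u v (≰⇒> φu≰εv)) ⟩
    Maybe.map (x ∷_) (Maybe.map (_++ v) (f̃⊗ i u))   ≡⟨ trans (sym (Maybeₚ.map-∘ (f̃⊗ i u))) (Maybeₚ.map-∘ (f̃⊗ i u)) ⟩
    Maybe.map (_++ v) (Maybe.map (x ∷_) (f̃⊗ i u))   ≡⟨ cong (Maybe.map (_++ v)) (f̃⊗-∷ʳ i x u (≮⇒≥ εu≮φx)) ⟨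
    Maybe.map (_++ v) (f̃⊗ i (x ∷ u))                ∎
    where
    open ≡-Reasoning
    ε≡ : ε⊗ i (u ++ v) ≡ ε⊗ i u
    ε≡ = ε⊗-++-≤ i u v (<⇒≤ (≰⇒> φu≰εv))

  ẽ⊗-length : ∀ i v {v'} → ẽ⊗ i v ≡ just v' → length v' ≡ length v
  ẽ⊗-length i (x ∷ v) ẽv≡ with φᴬ i x <ᵇ ε⊗ i v
  ... | true with ẽ⊗ i v in ẽv≡′
  ...   | just _ with refl ← ẽv≡ = cong suc (ẽ⊗-length i v ẽv≡′)
  ẽ⊗-length i (x ∷ v) ẽv≡ | false with ẽᴬ i x
  ...   | just _ with refl ← ẽv≡ = refl

  f̃⊗-length : ∀ i v {v'} → f̃⊗ i v ≡ just v' → length v' ≡ length v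
  f̃⊗-length i (x ∷ v) f̃v≡ with ε⊗ i v <ᵇ φᴬ i x
  ... | true with f̃ᴬ i x
  ...   | just _ with refl ← f̃v≡ = refl
  f̃⊗-length i (x ∷ v) f̃v≡ | false with f̃⊗ i v in f̃v≡′
  ...   | just _ with refl ← f̃v≡ = cong suc (f̃⊗-length i v f̃v≡′)

-- The crystal B(Λ₁) and its tensor powers

eL-string : ∀ i x → StringStep (eL i) (εL i) (φL i) x
eL-string i1 g1  = end refl refl
eL-string i1 g2  = step refl refl refl
eL-string i1 g3  = end refl refl
eL-string i1 g0  = step refl refl refl
eL-string i1 g3b = step refl refl refl
eL-string i1 g2b = end refl refl
eL-string i1 g1b = step refl refl refl
eL-string i2 g1  = end refl refl
eL-string i2 g2  = end refl refl
eL-string i2 g3  = step refl refl refl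
eL-string i2 g0  = end refl refl
eL-string i2 g3b = end refl refl
eL-string i2 g2b = step refl refl refl
eL-string i2 g1b = end refl refl

fL-string : ∀ i x → StringStep (fL i) (φL i) (εL i) x
fL-string i1 g1  = step refl refl refl
fL-string i1 g2  = end refl refl
fL-string i1 g3  = step refl refl refl
fL-string i1 g0  = step refl refl refl
fL-string i1 g3b = end refl refl
fL-string i1 g2b = step refl refl refl
fL-string i1 g1b = end refl refl
fL-string i2 g1  = end refl refl
fL-string i2 g2  = step refl refl refl
fL-string i2 g3  = end refl refl
fL-string i2 g0  = end refl refl
fL-string i2 g3b = step refl refl refl
fL-string i2 g2b = end refl refl
fL-string i2 g1b = end refl refl

open Signature eL fL εL φL eL-string fL-string

εL≤2 : ∀ i x → εL i x ≤ 2
εL≤2 i1 g3b = s≤s (s≤s z≤n)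
εL≤2 i1 g1  = z≤n
εL≤2 i1 g2  = s≤s z≤n
εL≤2 i1 g3  = z≤n
εL≤2 i1 g0  = s≤s z≤n
εL≤2 i1 g2b = z≤n
εL≤2 i1 g1b = s≤s z≤n
εL≤2 i2 g1  = z≤n
εL≤2 i2 g2  = z≤n
εL≤2 i2 g3  = s≤s z≤n
εL≤2 i2 g0  = z≤n
εL≤2 i2 g3b = z≤n
εL≤2 i2 g2b = s≤s z≤n
εL≤2 i2 g1b = z≤n

ε⊗≤2*length : ∀ i v → ε⊗ i v ≤ 2 * length v
ε⊗≤2*length i []      = z≤n
ε⊗≤2*length i (x ∷ v) = begin
  εL i x + (ε⊗ i v ∸ φL i x)  ≤⟨ +-mono-≤ (εL≤2 i x) (≤-trans (m∸n≤m (ε⊗ i v) (φL i x)) (ε⊗≤2*length i v)) ⟩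
  2 + 2 * length v            ≡⟨ *-suc 2 (length v) ⟨
  2 * suc (length v)          ∎
  where open ≤-Reasoning

-- εV counts ẽ-steps with fuel 3n + 1 > 2n ≥ ε⊗, so the fuel-bounded operators of Defs follow
-- the signature rule exactly.
mutual
  eV-toList : ∀ n i (v : Vec G n) → Maybe.map toList (eV n i v) ≡ ẽ⊗ i (toList v)
  eV-toList zero    i []      = refl
  eV-toList (suc n) i (x ∷ v) rewrite εV-toList n i v with φL i x <ᵇ ε⊗ i (toList v)
  ... | true  = trans (sym (Maybeₚ.map-∘ (eV n i v)))
                  (trans (Maybeₚ.map-∘ (eV n i v)) (cong (Maybe.map (x ∷_)) (eV-toList n i v)))
  ... | false = sym (Maybeₚ.map-∘ (eL i x))

  εV-toList : ∀ n i (v : Vec G n) → εV n i v ≡ ε⊗ i (toList v)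
  εV-toList n i v =
    count-exact (λ u → StringStep-map toList (eV-toList n i) u (ẽ⊗-string i (toList u))) (suc (3 * n)) v
      (s≤s (≤-trans (ε⊗≤2*length i (toList v))
                    (subst (λ m → 2 * m ≤ 3 * n) (sym (length-toList v)) (*-monoˡ-≤ n (n≤1+n 2)))))

fV-toList : ∀ n i (v : Vec G n) → Maybe.map toList (fV n i v) ≡ f̃⊗ i (toList v)
fV-toList zero    i []      = refl
fV-toList (suc n) i (x ∷ v) rewrite εV-toList n i v with ε⊗ i (toList v) <ᵇ φL i x
... | true  = sym (Maybeₚ.map-∘ (fL i x))
... | false = trans (sym (Maybeₚ.map-∘ (fV n i v)))
                (trans (Maybeₚ.map-∘ (fV n i v)) (cong (Maybe.map (x ∷_)) (fV-toList n i v)))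

ẽ≡ẽ⊗ : ∀ i w → ẽ i w ≡ ẽ⊗ i w
ẽ≡ẽ⊗ i w = trans (eV-toList (length w) i (fromList w)) (cong (ẽ⊗ i) (toList∘fromList w))

f̃≡f̃⊗ : ∀ i w → f̃ i w ≡ f̃⊗ i w
f̃≡f̃⊗ i w = trans (fV-toList (length w) i (fromList w)) (cong (f̃⊗ i) (toList∘fromList w))

-- Connected components of Γ

Step-f̃⊗ : ∀ i u {v} → f̃⊗ i u ≡ just v → Step u v
Step-f̃⊗ i u f̃u≡ = i , inj₁ (trans (f̃≡f̃⊗ i u) f̃u≡)

Step-ẽ⊗ : ∀ i u {v} → ẽ⊗ i u ≡ just v → Step u v
Step-ẽ⊗ i u ẽu≡ = i , inj₂ (trans (ẽ≡ẽ⊗ i u) ẽu≡)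

Step-length : ∀ {u v} → Step u v → length v ≡ length u
Step-length {u} (i , inj₁ f̃u≡) = f̃⊗-length i u (trans (sym (f̃≡f̃⊗ i u)) f̃u≡)
Step-length {u} (i , inj₂ ẽu≡) = ẽ⊗-length i u (trans (sym (ẽ≡ẽ⊗ i u)) ẽu≡)

∈B-length : ∀ {v h} → h ∈B v → length h ≡ length v
∈B-length ε = refl
∈B-length {v} (_◅_ {j = u} st rest) = trans (∈B-length rest) (Step-length {v} {u} st)

Step-++ : ∀ u v {s} → Step (u ++ v) s → (∃ λ u' → Step u u' × s ≡ u' ++ v) ⊎ (∃ λ v' → Step v v' × s ≡ u ++ v')
Step-++ u v (i , inj₁ f̃≡) with φ⊗ i u ≤? ε⊗ i v
... | yes φ≤ε with map≡just (f̃⊗ i v) (trans (sym (f̃⊗-++ʳ i u v φ≤ε)) (trans (sym (f̃≡f̃⊗ i (u ++ v))) f̃≡))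
...   | v' , f̃v≡ , refl = inj₂ (v' , Step-f̃⊗ i v f̃v≡ , refl)
Step-++ u v (i , inj₁ f̃≡) | no φ≰ε with map≡just (f̃⊗ i u) (trans (sym (f̃⊗-++ˡ i u v (≰⇒> φ≰ε))) (trans (sym (f̃≡f̃⊗ i (u ++ v))) f̃≡))
...   | u' , f̃u≡ , refl = inj₁ (u' , Step-f̃⊗ i u f̃u≡ , refl)
Step-++ u v (i , inj₂ ẽ≡) with φ⊗ i u <? ε⊗ i v
... | yes φ<ε with map≡just (ẽ⊗ i v) (trans (sym (ẽ⊗-++ʳ i u v φ<ε)) (trans (sym (ẽ≡ẽ⊗ i (u ++ v))) ẽ≡))
...   | v' , ẽv≡ , refl = inj₂ (v' , Step-ẽ⊗ i v ẽv≡ , refl)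
Step-++ u v (i , inj₂ ẽ≡) | no φ≮ε with map≡just (ẽ⊗ i u) (trans (sym (ẽ⊗-++ˡ i u v (≮⇒≥ φ≮ε))) (trans (sym (ẽ≡ẽ⊗ i (u ++ v))) ẽ≡))
...   | u' , ẽu≡ , refl = inj₁ (u' , Step-ẽ⊗ i u ẽu≡ , refl)

∈B-++ : ∀ u v {h} → h ∈B (u ++ v) → ∃₂ λ u' v' → h ≡ u' ++ v' × u' ∈B u × v' ∈B v
∈B-++ u v ε = u , v , refl , ε , ε
∈B-++ u v (st ◅ rest) with Step-++ u v st
... | inj₁ (u₁ , st₁ , refl) with ∈B-++ u₁ v rest
...   | u' , v' , refl , u'∈ , v'∈ = u' , v' , refl , st₁ ◅ u'∈ , v'∈
∈B-++ u v (st ◅ rest) | inj₂ (v₁ , st₁ , refl) with ∈B-++ u v₁ rest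
...   | u' , v' , refl , u'∈ , v'∈ = u' , v' , refl , u'∈ , st₁ ◅ v'∈

∈B-snoc : ∀ u x {h} → h ∈B (u ++ [ x ]) → ∃₂ λ h₀ y → h ≡ h₀ ++ [ y ] × h₀ ∈B u
∈B-snoc u x h∈ with ∈B-++ u [ x ] h∈
... | h₀ , v' , refl , h₀∈ , v'∈ with v' | ∈B-length v'∈
...   | y ∷ [] | _ = h₀ , y , refl , h₀∈

HighestWeight : Word → Set
HighestWeight v = ∀ i → ε⊗ i v ≡ 0

rankSum : Word → ℕ
rankSum = sum ∘ map rank

eL-rank : ∀ i x {x'} → eL i x ≡ just x' → suc (rank x') ≡ rank x
eL-rank i1 g2  refl = refl
eL-rank i1 g0  refl = refl
eL-rank i1 g3b refl = refl
eL-rank i1 g1b refl = refl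
eL-rank i2 g3  refl = refl
eL-rank i2 g2b refl = refl
eL-rank i1 g1  ()
eL-rank i1 g3  ()
eL-rank i1 g2b ()
eL-rank i2 g1  ()
eL-rank i2 g2  ()
eL-rank i2 g0  ()
eL-rank i2 g3b ()
eL-rank i2 g1b ()

ẽ⊗-rankSum : ∀ i v {v'} → ẽ⊗ i v ≡ just v' → rankSum v' < rankSum v
ẽ⊗-rankSum i (x ∷ v) ẽv≡ with φL i x <ᵇ ε⊗ i v
... | true with ẽ⊗ i v in ẽv≡′
...   | just _ with refl ← ẽv≡ = +-monoʳ-< (rank x) (ẽ⊗-rankSum i v ẽv≡′)
ẽ⊗-rankSum i (x ∷ v) ẽv≡ | false with eL i x in eLx≡
...   | just _ with refl ← ẽv≡ = +-monoˡ-≤ (rankSum v) (≤-reflexive (eL-rank i x eLx≡))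

raise-or-highest : ∀ v → (∃₂ λ i v' → ẽ⊗ i v ≡ just v') ⊎ HighestWeight v
raise-or-highest v with ẽ⊗ i1 v in ẽ₁≡ | ẽ⊗ i2 v in ẽ₂≡
... | just v' | _       = inj₁ (i1 , v' , ẽ₁≡)
... | nothing | just v' = inj₁ (i2 , v' , ẽ₂≡)
... | nothing | nothing = inj₂ λ { i1 → undefined⇒μ≡0 (ẽ⊗-string i1 v) ẽ₁≡
                                 ; i2 → undefined⇒μ≡0 (ẽ⊗-string i2 v) ẽ₂≡ }

highest-weight-∈B : ∀ v → ∃ λ h → h ∈B v × HighestWeight h
highest-weight-∈B v = go v (<-wellFounded (rankSum v))
  where
  go : ∀ v → Acc _<_ (rankSum v) → ∃ λ h → h ∈B v × HighestWeight h
  go v (acc rs) with raise-or-highest v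
  ... | inj₂ hw = v , ε , hw
  ... | inj₁ (i , v' , ẽv≡) with go v' (rs (ẽ⊗-rankSum i v ẽv≡))
  ...   | h , h∈ , hw = h , Step-ẽ⊗ i v ẽv≡ ◅ h∈ , hw

module _ {w₁ w₂ : Word} (iso : w₁ ∼ w₂) where

  private
    F = proj₁ iso

  ∈B-iso : ∀ {u} → u ∈B w₁ → F u ∈B w₂
  ∈B-iso = proj₁ (proj₂ (proj₂ iso)) _

  f̃⊗-iso : ∀ i {u} → u ∈B w₁ → Maybe.map F (f̃⊗ i u) ≡ f̃⊗ i (F u)
  f̃⊗-iso i {u} u∈ = begin
    Maybe.map F (f̃⊗ i u)  ≡⟨ cong (Maybe.map F) (f̃≡f̃⊗ i u) ⟨
    Maybe.map F (f̃ i u)   ≡⟨ proj₁ (proj₂ (proj₂ (proj₂ iso))) u u∈ i ⟩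
    f̃ i (F u)             ≡⟨ f̃≡f̃⊗ i (F u) ⟩
    f̃⊗ i (F u)            ∎
    where open ≡-Reasoning

  ẽ⊗-iso : ∀ i {u} → u ∈B w₁ → Maybe.map F (ẽ⊗ i u) ≡ ẽ⊗ i (F u)
  ẽ⊗-iso i {u} u∈ = begin
    Maybe.map F (ẽ⊗ i u)  ≡⟨ cong (Maybe.map F) (ẽ≡ẽ⊗ i u) ⟨
    Maybe.map F (ẽ i u)   ≡⟨ proj₁ (proj₂ (proj₂ (proj₂ (proj₂ iso)))) u u∈ i ⟩
    ẽ i (F u)             ≡⟨ ẽ≡ẽ⊗ i (F u) ⟩
    ẽ⊗ i (F u)            ∎
    where open ≡-Reasoning

  φ⊗-iso : ∀ i {u} → u ∈B w₁ → φ⊗ i (F u) ≡ φ⊗ i u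
  φ⊗-iso i {u} u∈ = go (φ⊗ i u) u∈ refl
    where
    go : ∀ n {u} → u ∈B w₁ → φ⊗ i u ≡ n → φ⊗ i (F u) ≡ n
    go n {u} u∈ φu≡n with f̃⊗-string i u | f̃⊗-string i (F u) | f̃⊗-iso i u∈
    ... | end f̃u≡ φu≡0 | end _ φFu≡0 | _ = trans φFu≡0 (trans (sym φu≡0) φu≡n)
    ... | end f̃u≡ _ | step f̃Fu≡ _ _ | comm with () ← trans (sym (cong (Maybe.map F) f̃u≡)) (trans comm f̃Fu≡)
    ... | step f̃u≡ _ _ | end f̃Fu≡ _ | comm with () ← trans (sym (cong (Maybe.map F) f̃u≡)) (trans comm f̃Fu≡)
    ... | step {u'} f̃u≡ φu≡ _ | step f̃Fu≡ φFu≡ _ | comm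
      with refl ← trans (sym (cong (Maybe.map F) f̃u≡)) (trans comm f̃Fu≡) | n
    ...   | suc m = trans φFu≡ (cong suc (go m (u∈ ◅◅ Step-f̃⊗ i u f̃u≡ ◅ ε) (suc-injective (trans (sym φu≡) φu≡n))))
    ...   | zero  with () ← trans (sym φu≡) φu≡n

  HighestWeight-iso : ∀ {u} → u ∈B w₁ → HighestWeight u → HighestWeight (F u)
  HighestWeight-iso {u} u∈ hw i =
    undefined⇒μ≡0 (ẽ⊗-string i (F u))
      (trans (sym (ẽ⊗-iso i u∈)) (cong (Maybe.map F) (μ≡0⇒undefined (ẽ⊗-string i u) (hw i))))

-- Columns

readColumns : Tableau → Word
readColumns []      = []
readColumns (C ∷ t) = readColumns t ++ colWord C

readWord≡readColumns : ∀ t → readWord t ≡ readColumns t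
readWord≡readColumns []      = refl
readWord≡readColumns (C ∷ t) = begin
  concatMap colWord (reverse (C ∷ t))              ≡⟨ cong (concatMap colWord) (Listₚ.unfold-reverse C t) ⟩
  concatMap colWord (reverse t ++ [ C ])           ≡⟨ Listₚ.concatMap-++ colWord (reverse t) [ C ] ⟩
  concatMap colWord (reverse t) ++ colWord C ++ [] ≡⟨ cong₂ _++_ (readWord≡readColumns t) (Listₚ.++-identityʳ (colWord C)) ⟩
  readColumns t ++ colWord C                       ∎
  where open ≡-Reasoning

ẽC f̃C : I → Column → Maybe Column
ẽC i (col1 a)   = Maybe.map col1 (eL i a)
ẽC i (col2 a b) =
  if φL i a <ᵇ εL i b then Maybe.map (col2 a) (eL i b) else Maybe.map (λ a' → col2 a' b) (eL i a)
f̃C i (col1 a)   = Maybe.map col1 (fL i a)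
f̃C i (col2 a b) =
  if εL i b <ᵇ φL i a then Maybe.map (λ a' → col2 a' b) (fL i a) else Maybe.map (col2 a) (fL i b)

ẽ⊗-colWord : ∀ i C → ẽ⊗ i (colWord C) ≡ Maybe.map colWord (ẽC i C)
ẽ⊗-colWord i (col1 a)   = Maybeₚ.map-∘ (eL i a)
ẽ⊗-colWord i (col2 a b) rewrite ε⊗-singleton i b with φL i a <ᵇ εL i b
... | true  = trans (sym (Maybeₚ.map-∘ (eL i b))) (Maybeₚ.map-∘ (eL i b))
... | false = Maybeₚ.map-∘ (eL i a)

f̃⊗-colWord : ∀ i C → f̃⊗ i (colWord C) ≡ Maybe.map colWord (f̃C i C)
f̃⊗-colWord i (col1 a)   = trans (f̃⊗-singleton i a) (Maybeₚ.map-∘ (fL i a))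
f̃⊗-colWord i (col2 a b) rewrite ε⊗-singleton i b | f̃⊗-singleton i b with εL i b <ᵇ φL i a
... | true  = Maybeₚ.map-∘ (fL i a)
... | false = trans (sym (Maybeₚ.map-∘ (fL i b))) (Maybeₚ.map-∘ (fL i b))

height2-length : ∀ {C C'} → length (colWord C') ≡ length (colWord C) → height2 C' ≡ height2 C
height2-length {col1 _}   {col1 _}   _ = refl
height2-length {col2 _ _} {col2 _ _} _ = refl

ẽC-height2 : ∀ i {C C'} → ẽC i C ≡ just C' → height2 C' ≡ height2 C
ẽC-height2 i {C} ẽC≡ = height2-length (ẽ⊗-length i (colWord C) (trans (ẽ⊗-colWord i C) (cong (Maybe.map colWord) ẽC≡)))

f̃C-height2 : ∀ i {C C'} → f̃C i C ≡ just C' → height2 C' ≡ height2 C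
f̃C-height2 i {C} f̃C≡ = height2-length (f̃⊗-length i (colWord C) (trans (f̃⊗-colWord i C) (cong (Maybe.map colWord) f̃C≡)))

infixr 5 _⇒ᵇ_
_⇒ᵇ_ : Bool → Bool → Bool
a ⇒ᵇ b = not a ∨ b

⇒ᵇ-mp : ∀ {a b} → T (a ⇒ᵇ b) → T a → T b
⇒ᵇ-mp {true} Tb _ = Tb

holdsFor : {X : Set} → (X → Bool) → Maybe X → Bool
holdsFor p = maybe′ p true

holdsFor-just : {X : Set} {p : X → Bool} {m : Maybe X} {x : X} → T (holdsFor p m) → m ≡ just x → T (p x)
holdsFor-just Tp refl = Tp

letters : List G
letters = g1 ∷ g2 ∷ g3 ∷ g0 ∷ g3b ∷ g2b ∷ g1b ∷ []

∈-letters : ∀ x → x ∈ letters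
∈-letters g1  = here refl
∈-letters g2  = there (here refl)
∈-letters g3  = there (there (here refl))
∈-letters g0  = there (there (there (here refl)))
∈-letters g3b = there (there (there (there (here refl))))
∈-letters g2b = there (there (there (there (there (here refl)))))
∈-letters g1b = there (there (there (there (there (there (here refl))))))

allLetters : (G → Bool) → Bool
allLetters p = all p letters

allLetters-sound : ∀ p → T (allLetters p) → ∀ x → T (p x)
allLetters-sound p Tall x = All.lookup (all⁺ p letters Tall) (∈-letters x)

allColumns : (Column → Bool) → Bool
allColumns p = allLetters (λ a → p (col1 a)) ∧ allLetters (λ a → allLetters (λ b → p (col2 a b)))

allColumns-sound : ∀ p → T (allColumns p) → ∀ C → T (p C)
allColumns-sound p Tall (col1 a)   =
  allLetters-sound (λ a → p (col1 a)) (proj₁ (Equivalence.to T-∧ Tall)) a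
allColumns-sound p Tall (col2 a b) =
  allLetters-sound (λ b → p (col2 a b))
    (allLetters-sound (λ a → allLetters (λ b → p (col2 a b)))
      (proj₂ (Equivalence.to (T-∧ {allLetters (λ a → p (col1 a))}) Tall)) a) b

allColumnPairs-sound : ∀ (p : Column → Column → Bool) → T (allColumns λ X → allColumns (p X)) → ∀ X Y → T (p X Y)
allColumnPairs-sound p Tall X = allColumns-sound (p X) (allColumns-sound (λ X → allColumns (p X)) Tall X)

admissible-closed : (Column → Maybe Column) → Column → Bool
admissible-closed op C = admissibleᵇ C ⇒ᵇ holdsFor admissibleᵇ (op C)

ẽC-admissible-holds : ∀ i → T (allColumns (admissible-closed (ẽC i)))
ẽC-admissible-holds i1 = tt
ẽC-admissible-holds i2 = tt

f̃C-admissible-holds : ∀ i → T (allColumns (admissible-closed (f̃C i)))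
f̃C-admissible-holds i1 = tt
f̃C-admissible-holds i2 = tt

ẽC-admissible : ∀ i C {C'} → Admissible C → ẽC i C ≡ just C' → Admissible C'
ẽC-admissible i C adm =
  holdsFor-just (⇒ᵇ-mp (allColumns-sound (admissible-closed (ẽC i)) (ẽC-admissible-holds i) C) adm)

f̃C-admissible : ∀ i C {C'} → Admissible C → f̃C i C ≡ just C' → Admissible C'
f̃C-admissible i C adm =
  holdsFor-just (⇒ᵇ-mp (allColumns-sound (admissible-closed (f̃C i)) (f̃C-admissible-holds i) C) adm)

-- The combinatorial content of Kang–Misra's closure theorem, decided by evaluation on all
-- pairs of adjacent columns.
ẽC-⪯ˡ-check ẽC-⪯ʳ-check f̃C-⪯ˡ-check f̃C-⪯ʳ-check : I → Column → Column → Bool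
ẽC-⪯ˡ-check i X Y = admissibleᵇ X ⇒ᵇ admissibleᵇ Y ⇒ᵇ colLeqᵇ X Y ⇒ᵇ
  (φ⊗ i (colWord Y) <ᵇ ε⊗ i (colWord X)) ⇒ᵇ holdsFor (λ X' → colLeqᵇ X' Y) (ẽC i X)
ẽC-⪯ʳ-check i X Y = admissibleᵇ X ⇒ᵇ admissibleᵇ Y ⇒ᵇ colLeqᵇ X Y ⇒ᵇ
  (ε⊗ i (colWord X) ≤ᵇ φ⊗ i (colWord Y)) ⇒ᵇ holdsFor (colLeqᵇ X) (ẽC i Y)
f̃C-⪯ˡ-check i X Y = admissibleᵇ X ⇒ᵇ admissibleᵇ Y ⇒ᵇ colLeqᵇ X Y ⇒ᵇ
  (φ⊗ i (colWord Y) ≤ᵇ ε⊗ i (colWord X)) ⇒ᵇ holdsFor (λ X' → colLeqᵇ X' Y) (f̃C i X)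
f̃C-⪯ʳ-check i X Y = admissibleᵇ X ⇒ᵇ admissibleᵇ Y ⇒ᵇ colLeqᵇ X Y ⇒ᵇ
  (ε⊗ i (colWord X) <ᵇ φ⊗ i (colWord Y)) ⇒ᵇ holdsFor (colLeqᵇ X) (f̃C i Y)

ẽC-⪯ˡ-holds : ∀ i → T (allColumns λ X → allColumns (ẽC-⪯ˡ-check i X))
ẽC-⪯ˡ-holds i1 = tt
ẽC-⪯ˡ-holds i2 = tt

ẽC-⪯ʳ-holds : ∀ i → T (allColumns λ X → allColumns (ẽC-⪯ʳ-check i X))
ẽC-⪯ʳ-holds i1 = tt
ẽC-⪯ʳ-holds i2 = tt

f̃C-⪯ˡ-holds : ∀ i → T (allColumns λ X → allColumns (f̃C-⪯ˡ-check i X))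
f̃C-⪯ˡ-holds i1 = tt
f̃C-⪯ˡ-holds i2 = tt

f̃C-⪯ʳ-holds : ∀ i → T (allColumns λ X → allColumns (f̃C-⪯ʳ-check i X))
f̃C-⪯ʳ-holds i1 = tt
f̃C-⪯ʳ-holds i2 = tt

module _ (X Y : Column) (adm-X : Admissible X) (adm-Y : Admissible Y) (X⪯Y : X ⪯C Y) where

  private
    adjacent-mp : ∀ {b} → T (admissibleᵇ X ⇒ᵇ admissibleᵇ Y ⇒ᵇ colLeqᵇ X Y ⇒ᵇ b) → T b
    adjacent-mp check = ⇒ᵇ-mp (⇒ᵇ-mp (⇒ᵇ-mp check adm-X) adm-Y) X⪯Y

  ẽC-⪯ˡ : ∀ i {X'} → φ⊗ i (colWord Y) < ε⊗ i (colWord X) → ẽC i X ≡ just X' → X' ⪯C Y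
  ẽC-⪯ˡ i lt = holdsFor-just (⇒ᵇ-mp (adjacent-mp (allColumnPairs-sound (ẽC-⪯ˡ-check i) (ẽC-⪯ˡ-holds i) X Y)) (<⇒<ᵇ lt))

  ẽC-⪯ʳ : ∀ i {Y'} → ε⊗ i (colWord X) ≤ φ⊗ i (colWord Y) → ẽC i Y ≡ just Y' → X ⪯C Y'
  ẽC-⪯ʳ i le = holdsFor-just (⇒ᵇ-mp (adjacent-mp (allColumnPairs-sound (ẽC-⪯ʳ-check i) (ẽC-⪯ʳ-holds i) X Y)) (<⇒<ᵇ (s≤s le)))

  f̃C-⪯ˡ : ∀ i {X'} → φ⊗ i (colWord Y) ≤ ε⊗ i (colWord X) → f̃C i X ≡ just X' → X' ⪯C Y
  f̃C-⪯ˡ i le = holdsFor-just (⇒ᵇ-mp (adjacent-mp (allColumnPairs-sound (f̃C-⪯ˡ-check i) (f̃C-⪯ˡ-holds i) X Y)) (<⇒<ᵇ (s≤s le)))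

  f̃C-⪯ʳ : ∀ i {Y'} → ε⊗ i (colWord X) < φ⊗ i (colWord Y) → f̃C i Y ≡ just Y' → X ⪯C Y'
  f̃C-⪯ʳ i lt = holdsFor-just (⇒ᵇ-mp (adjacent-mp (allColumnPairs-sound (f̃C-⪯ʳ-check i) (f̃C-⪯ʳ-holds i) X Y)) (<⇒<ᵇ lt))

-- Kashiwara operators on tableaux

-- t' arises from t by applying op to the one column selected by the signature rule on
-- readColumns t: Here C t says that the rule picks C, There C t that it passes C to t.
data ColumnStep (op : Column → Maybe Column) (Here There : Column → Tableau → Set) : Tableau → Tableau → Set where
  here  : ∀ {C C' t} → Here C t → op C ≡ just C' → ColumnStep op Here There (C ∷ t) (C' ∷ t)
  there : ∀ {C t t'} → There C t → ColumnStep op Here There t t' → ColumnStep op Here There (C ∷ t) (C ∷ t')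

ẼStep F̃Step : I → Tableau → Tableau → Set
ẼStep i = ColumnStep (ẽC i) (λ C t → φ⊗ i (readColumns t) < ε⊗ i (colWord C))
                            (λ C t → ε⊗ i (colWord C) ≤ φ⊗ i (readColumns t))
F̃Step i = ColumnStep (f̃C i) (λ C t → φ⊗ i (readColumns t) ≤ ε⊗ i (colWord C))
                            (λ C t → ε⊗ i (colWord C) < φ⊗ i (readColumns t))

shape-∷ : ∀ C C' t t' → height2 C' ≡ height2 C → shape t' ≡ shape t → shape (C' ∷ t') ≡ shape (C ∷ t)
shape-∷ C C' t t' h≡ s≡ rewrite h≡ | s≡ = refl

ColumnStep-shape : ∀ {op Here There} → (∀ {C C'} → op C ≡ just C' → height2 C' ≡ height2 C) →
                   ∀ {t t'} → ColumnStep op Here There t t' → shape t' ≡ shape t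
ColumnStep-shape op-height2 (here {C} {C'} {t} _ op≡) = shape-∷ C C' t t (op-height2 op≡) refl
ColumnStep-shape op-height2 (there {C} {t} {t'} _ move) = shape-∷ C C t t' refl (ColumnStep-shape op-height2 move)

ẽ⊗-readColumns : ∀ i t {W} → ẽ⊗ i (readColumns t) ≡ just W → ∃ λ t' → ẼStep i t t' × readColumns t' ≡ W
ẽ⊗-readColumns i (C ∷ t) ẽ≡ with φ⊗ i (readColumns t) <? ε⊗ i (colWord C)
... | yes φ<ε with map≡just (ẽC i C)
                   (trans (sym (trans (ẽ⊗-++ʳ i (readColumns t) (colWord C) φ<ε)
                                      (trans (cong (Maybe.map _) (ẽ⊗-colWord i C)) (sym (Maybeₚ.map-∘ (ẽC i C)))))) ẽ≡)
...   | C' , ẽC≡ , refl = C' ∷ t , here φ<ε ẽC≡ , refl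
ẽ⊗-readColumns i (C ∷ t) ẽ≡ | no φ≮ε
  with map≡just (ẽ⊗ i (readColumns t)) (trans (sym (ẽ⊗-++ˡ i (readColumns t) (colWord C) (≮⇒≥ φ≮ε))) ẽ≡)
...   | W₀ , ẽ₀≡ , refl with ẽ⊗-readColumns i t ẽ₀≡
...     | t' , move , refl = C ∷ t' , there (≮⇒≥ φ≮ε) move , refl

f̃⊗-readColumns : ∀ i t {W} → f̃⊗ i (readColumns t) ≡ just W → ∃ λ t' → F̃Step i t t' × readColumns t' ≡ W
f̃⊗-readColumns i (C ∷ t) f̃≡ with φ⊗ i (readColumns t) ≤? ε⊗ i (colWord C)
... | yes φ≤ε with map≡just (f̃C i C)
                   (trans (sym (trans (f̃⊗-++ʳ i (readColumns t) (colWord C) φ≤ε)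
                                      (trans (cong (Maybe.map _) (f̃⊗-colWord i C)) (sym (Maybeₚ.map-∘ (f̃C i C)))))) f̃≡)
...   | C' , f̃C≡ , refl = C' ∷ t , here φ≤ε f̃C≡ , refl
f̃⊗-readColumns i (C ∷ t) f̃≡ | no φ≰ε
  with map≡just (f̃⊗ i (readColumns t)) (trans (sym (f̃⊗-++ˡ i (readColumns t) (colWord C) (≰⇒> φ≰ε))) f̃≡)
...   | W₀ , f̃₀≡ , refl with f̃⊗-readColumns i t f̃₀≡
...     | t' , move , refl = C ∷ t' , there (≰⇒> φ≰ε) move , refl

ẼStep-IsTableau : ∀ i {t t'} → IsTableau t → ẼStep i t t' → IsTableau t'
ẼStep-IsTableau i (adm-C ∷ adm-t , _) (here {C} {t = []} _ ẽC≡) =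
  ẽC-admissible i C adm-C ẽC≡ ∷ adm-t , [-]
ẼStep-IsTableau i (adm-C ∷ adm-t , C⪯H ∷ linked) (here {C} {t = H ∷ t} φ<ε ẽC≡) =
  ẽC-admissible i C adm-C ẽC≡ ∷ adm-t ,
  ẽC-⪯ˡ C H adm-C (All.head adm-t) C⪯H i (≤-<-trans (φ⊗≤φ⊗-++ i (readColumns t) (colWord H)) φ<ε) ẽC≡ ∷ linked
ẼStep-IsTableau i (adm-C ∷ adm-t , C⪯H ∷ linked) (there {C} ε≤φ move@(here {H} {t = t} φ<ε ẽH≡)) =
  let adm-t' , linked' = ẼStep-IsTableau i (adm-t , linked) move
      φ≡ = φ⊗-++-≤ i (readColumns t) (colWord H) (<⇒≤ φ<ε)
  in adm-C ∷ adm-t' , ẽC-⪯ʳ C H adm-C (All.head adm-t) C⪯H i (subst (_ ≤_) φ≡ ε≤φ) ẽH≡ ∷ linked'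
ẼStep-IsTableau i (adm-C ∷ adm-t , C⪯H ∷ linked) (there _ move@(there _ _)) =
  let adm-t' , linked' = ẼStep-IsTableau i (adm-t , linked) move
  in adm-C ∷ adm-t' , C⪯H ∷ linked'

F̃Step-IsTableau : ∀ i {t t'} → IsTableau t → F̃Step i t t' → IsTableau t'
F̃Step-IsTableau i (adm-C ∷ adm-t , _) (here {C} {t = []} _ f̃C≡) =
  f̃C-admissible i C adm-C f̃C≡ ∷ adm-t , [-]
F̃Step-IsTableau i (adm-C ∷ adm-t , C⪯H ∷ linked) (here {C} {t = H ∷ t} φ≤ε f̃C≡) =
  f̃C-admissible i C adm-C f̃C≡ ∷ adm-t ,
  f̃C-⪯ˡ C H adm-C (All.head adm-t) C⪯H i (≤-trans (φ⊗≤φ⊗-++ i (readColumns t) (colWord H)) φ≤ε) f̃C≡ ∷ linked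
F̃Step-IsTableau i (adm-C ∷ adm-t , C⪯H ∷ linked) (there {C} ε<φ move@(here {H} {t = t} φ≤ε f̃H≡)) =
  let adm-t' , linked' = F̃Step-IsTableau i (adm-t , linked) move
      φ≡ = φ⊗-++-≤ i (readColumns t) (colWord H) φ≤ε
  in adm-C ∷ adm-t' , f̃C-⪯ʳ C H adm-C (All.head adm-t) C⪯H i (subst (_ <_) φ≡ ε<φ) f̃H≡ ∷ linked'
F̃Step-IsTableau i (adm-C ∷ adm-t , C⪯H ∷ linked) (there _ move@(there _ _)) =
  let adm-t' , linked' = F̃Step-IsTableau i (adm-t , linked) move
  in adm-C ∷ adm-t' , C⪯H ∷ linked'

∈B-tableau : ∀ {t u} → IsTableau t → u ∈B readColumns t →
             ∃ λ t' → IsTableau t' × readColumns t' ≡ u × shape t' ≡ shape t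
∈B-tableau {t} tab ε = t , tab , refl , refl
∈B-tableau {t} tab ((i , inj₁ f̃≡) ◅ rest) with f̃⊗-readColumns i t (trans (sym (f̃≡f̃⊗ i (readColumns t))) f̃≡)
... | t₁ , move , refl with ∈B-tableau (F̃Step-IsTableau i tab move) rest
...   | t' , tab' , refl , shape≡ = t' , tab' , refl , trans shape≡ (ColumnStep-shape (f̃C-height2 i) move)
∈B-tableau {t} tab ((i , inj₂ ẽ≡) ◅ rest) with ẽ⊗-readColumns i t (trans (sym (ẽ≡ẽ⊗ i (readColumns t))) ẽ≡)
... | t₁ , move , refl with ∈B-tableau (ẼStep-IsTableau i tab move) rest
...   | t' , tab' , refl , shape≡ = t' , tab' , refl , trans shape≡ (ColumnStep-shape (ẽC-height2 i) move)

-- Highest-weight tableaux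

youngDiagram : ℕ → ℕ → Diagram
youngDiagram λ₁ λ₂ = λ₁ + λ₂ , λ₂

-- For a highest-weight word v this is Y(wt v), since then φ_i(v) = ⟨h_i , wt v⟩.
φ-diagram : Word → Diagram
φ-diagram v = youngDiagram (φ⊗ i1 v) (φ⊗ i2 v)

highestᵇ : Word → Bool
highestᵇ v = (ε⊗ i1 v ≡ᵇ 0) ∧ (ε⊗ i2 v ≡ᵇ 0)

highestᵇ-sound : ∀ v → T (highestᵇ v) → HighestWeight v
highestᵇ-sound v Thw i1 = ≡ᵇ⇒≡ _ 0 (proj₁ (Equivalence.to T-∧ Thw))
highestᵇ-sound v Thw i2 = ≡ᵇ⇒≡ _ 0 (proj₂ (Equivalence.to (T-∧ {ε⊗ i1 v ≡ᵇ 0}) Thw))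

highestᵇ-complete : ∀ v → HighestWeight v → T (highestᵇ v)
highestᵇ-complete v hw = Equivalence.from T-∧ (≡⇒≡ᵇ _ 0 (hw i1) , ≡⇒≡ᵇ _ 0 (hw i2))

highest-column-check : Column → Bool
highest-column-check C = admissibleᵇ C ⇒ᵇ highestᵇ (colWord C) ⇒ᵇ
  (φ⊗ i1 (colWord C) + height2 C ≡ᵇ 1) ∧ (φ⊗ i2 (colWord C) ≡ᵇ height2 C)

highest-column-holds : T (allColumns highest-column-check)
highest-column-holds = tt

highest-column : ∀ C → Admissible C → HighestWeight (colWord C) →
                 φ⊗ i1 (colWord C) + height2 C ≡ 1 × φ⊗ i2 (colWord C) ≡ height2 C
highest-column C adm hw =
  let φ₁≡ , φ₂≡ = Equivalence.to T-∧
        (⇒ᵇ-mp (⇒ᵇ-mp (allColumns-sound highest-column-check highest-column-holds C) adm) (highestᵇ-complete (colWord C) hw))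
  in ≡ᵇ⇒≡ _ 1 φ₁≡ , ≡ᵇ⇒≡ _ _ φ₂≡

-- If H is a single box the second row is empty, so φ₂ = 0 forces ε₂(C) = 0; this rules
-- out C = (1, 3).
highest-before-check : Column → Column → Bool
highest-before-check C H = admissibleᵇ C ⇒ᵇ admissibleᵇ H ⇒ᵇ colLeqᵇ C H ⇒ᵇ highestᵇ (colWord H) ⇒ᵇ
  ((height2 H ≡ᵇ 1) ∨ (ε⊗ i2 (colWord C) ≡ᵇ 0)) ⇒ᵇ highestᵇ (colWord C)

highest-before-holds : T (allColumns λ C → allColumns (highest-before-check C))
highest-before-holds = tt

second-row-empty : ∀ a t → Linked _⪯C_ (col1 a ∷ t) → proj₂ (shape (col1 a ∷ t)) ≡ 0
second-row-empty a []             _              = refl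
second-row-empty a (col1 b ∷ t)   (_ ∷ linked)   = second-row-empty b t linked
second-row-empty a (col2 _ _ ∷ t) (() ∷ _)

shape-∷-highest : ∀ C t {a b p q} → shape t ≡ youngDiagram a b → p + height2 C ≡ 1 → q ≡ height2 C →
                  shape (C ∷ t) ≡ youngDiagram (p + a) (q + b)
shape-∷-highest (col1 _) t {p = p} shape≡ p+0≡1 refl
  rewrite shape≡ | trans (sym (+-identityʳ p)) p+0≡1 = refl
shape-∷-highest (col2 _ _) t {a} {b} {p} shape≡ p+1≡1 refl
  rewrite shape≡ | +-cancelʳ-≡ 1 p 0 p+1≡1 = cong (_, suc b) (sym (+-suc a b))

first-column-highest : ∀ C t → Admissible C → All Admissible t → Linked _⪯C_ (C ∷ t) →
                       All (HighestWeight ∘ colWord) t → proj₂ (shape t) ≡ φ⊗ i2 (readColumns t) →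
                       (∀ i → ε⊗ i (colWord C) ≤ φ⊗ i (readColumns t)) → HighestWeight (colWord C)
first-column-highest C []      _     _           _              _    _    ε≤φ i = n≤0⇒n≡0 (ε≤φ i)
first-column-highest C (H ∷ t) adm-C (adm-H ∷ _) (C⪯H ∷ linked) (hw-H ∷ _) row₂≡ ε≤φ =
  highestᵇ-sound (colWord C)
    (⇒ᵇ-mp (⇒ᵇ-mp (⇒ᵇ-mp (⇒ᵇ-mp (⇒ᵇ-mp check adm-C) adm-H) C⪯H) (highestᵇ-complete (colWord H) hw-H))
           (side H linked (ε≤φ i2) row₂≡))
  where
  check = allColumnPairs-sound highest-before-check highest-before-holds C H
  side : ∀ H → Linked _⪯C_ (H ∷ t) → ε⊗ i2 (colWord C) ≤ φ⊗ i2 (readColumns (H ∷ t)) →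
         proj₂ (shape (H ∷ t)) ≡ φ⊗ i2 (readColumns (H ∷ t)) → T ((height2 H ≡ᵇ 1) ∨ (ε⊗ i2 (colWord C) ≡ᵇ 0))
  side (col2 _ _) _      _    _     = tt
  side (col1 a)   linked ε≤φ₂ row₂≡ =
    ≡⇒≡ᵇ _ 0 (n≤0⇒n≡0 (subst (ε⊗ i2 (colWord C) ≤_) (trans (sym row₂≡) (second-row-empty a t linked)) ε≤φ₂))

highest-weight-tableau : ∀ t → IsTableau t → HighestWeight (readColumns t) →
                         shape t ≡ φ-diagram (readColumns t) × All (HighestWeight ∘ colWord) t
highest-weight-tableau []      _                          _  = refl , []
highest-weight-tableau (C ∷ t) (adm-C ∷ adm-t , linked) hw = shape≡ , hw-C ∷ hw-t
  where
  split : ∀ i → ε⊗ i (readColumns t) ≡ 0 × ε⊗ i (colWord C) ≤ φ⊗ i (readColumns t)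
  split i = ε⊗-++≡0 i (readColumns t) (colWord C) (hw i)
  ih = highest-weight-tableau t (adm-t , Linked.tail linked) (proj₁ ∘ split)
  hw-t = proj₂ ih
  hw-C : HighestWeight (colWord C)
  hw-C = first-column-highest C t adm-C adm-t linked hw-t (cong proj₂ (proj₁ ih)) (proj₂ ∘ split)
  φ≡ : ∀ i → φ⊗ i (readColumns (C ∷ t)) ≡ φ⊗ i (colWord C) + φ⊗ i (readColumns t)
  φ≡ i = φ⊗-++-ε≡0 i (readColumns t) (colWord C) (hw-C i)
  shape≡ : shape (C ∷ t) ≡ φ-diagram (readColumns (C ∷ t))
  shape≡ = trans (shape-∷-highest C t (proj₁ ih) (proj₁ (highest-column C adm-C hw-C)) (proj₂ (highest-column C adm-C hw-C)))
                 (sym (cong₂ youngDiagram (φ≡ i1) (φ≡ i2)))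

-- Oscillating tableaux

oscStep-letter : ∀ y a b → ε⊗ i1 [ y ] ≤ a → ε⊗ i2 [ y ] ≤ b →
                 OscStep (youngDiagram a b)
                         (youngDiagram (φ⊗ i1 [ y ] + (a ∸ ε⊗ i1 [ y ])) (φ⊗ i2 [ y ] + (b ∸ ε⊗ i2 [ y ])))
oscStep-letter g1  a             b       _         _         = inj₁ (inj₁ (refl , refl))
oscStep-letter g2  (suc a)       b       _         _         = inj₁ (inj₂ (+-suc a b , refl))
oscStep-letter g3  a             (suc b) _         _         = inj₂ (inj₂ (inj₂ (inj₁ (refl , cong suc (sym (+-suc a b))))))
oscStep-letter g0  (suc a)       b       _         _         = inj₂ (inj₂ (inj₁ (refl , refl)))
oscStep-letter g3b (suc (suc a)) b       _         _         = inj₂ (inj₂ (inj₂ (inj₂ (refl , cong suc (sym (+-suc a b))))))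
oscStep-letter g2b a             (suc b) _         _         = inj₂ (inj₁ (inj₂ (+-suc a b , refl)))
oscStep-letter g1b (suc a)       b       _         _         = inj₂ (inj₁ (inj₁ (refl , refl)))
oscStep-letter g2  zero          _       ()        _
oscStep-letter g3  _             zero    _         ()
oscStep-letter g0  zero          _       ()        _
oscStep-letter g3b zero          _       ()        _
oscStep-letter g3b (suc zero)    _       (s≤s ())  _
oscStep-letter g2b _             zero    _         ()
oscStep-letter g1b zero          _       ()        _

oscStep-append-letter : ∀ h y → HighestWeight (h ++ [ y ]) → OscStep (φ-diagram h) (φ-diagram (h ++ [ y ]))
oscStep-append-letter h y hw rewrite φ⊗-++ i1 h [ y ] | φ⊗-++ i2 h [ y ] =
  oscStep-letter y (φ⊗ i1 h) (φ⊗ i2 h) (proj₂ (ε⊗-++≡0 i1 h [ y ] (hw i1))) (proj₂ (ε⊗-++≡0 i2 h [ y ] (hw i2)))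

shape≡φ-diagram : ∀ {u t h} → IsTableau t → u ∼ readWord t → h ∈B u → HighestWeight h → shape t ≡ φ-diagram h
shape≡φ-diagram {t = t} {h} tab iso h∈ hw
  with ∈B-tableau tab (subst (proj₁ iso h ∈B_) (readWord≡readColumns t) (∈B-iso iso h∈))
... | t' , tab' , read≡ , shape≡ = begin
  shape t                      ≡⟨ shape≡ ⟨
  shape t'                     ≡⟨ proj₁ (highest-weight-tableau t' tab' hw') ⟩
  φ-diagram (readColumns t')   ≡⟨ cong φ-diagram read≡ ⟩
  φ-diagram (proj₁ iso h)      ≡⟨ cong₂ youngDiagram (φ⊗-iso iso i1 h∈) (φ⊗-iso iso i2 h∈) ⟩
  φ-diagram h                  ∎
  where
  open ≡-Reasoning
  hw' : HighestWeight (readColumns t')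
  hw' = subst HighestWeight (sym read≡) (HighestWeight-iso iso h∈ hw)

oscStep-snoc : ∀ u x {t t'} → IsTableau t → IsTableau t' → u ∼ readWord t → (u ++ [ x ]) ∼ readWord t' →
               OscStep (shape t) (shape t')
oscStep-snoc u x tab tab' iso iso' with highest-weight-∈B (u ++ [ x ])
... | h , h∈ , hw with ∈B-snoc u x h∈
...   | h₀ , y , refl , h₀∈ =
  subst₂ OscStep (sym (shape≡φ-diagram tab iso h₀∈ hw₀)) (sym (shape≡φ-diagram tab' iso' h∈ hw))
    (oscStep-append-letter h₀ y hw)
  where
  hw₀ : HighestWeight h₀
  hw₀ i = proj₁ (ε⊗-++≡0 i h₀ [ y ] (hw i))

shape-isYoungDiagram : ∀ t → IsYoungDiagram (shape t)
shape-isYoungDiagram []             = z≤n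
shape-isYoungDiagram (col1 _ ∷ t)   = m≤n⇒m≤1+n (shape-isYoungDiagram t)
shape-isYoungDiagram (col2 _ _ ∷ t) = s≤s (shape-isYoungDiagram t)

take-suc-++ : {A : Set} (w : List A) (k : ℕ) → k < length w → ∃ λ x → take (suc k) w ≡ take k w ++ [ x ]
take-suc-++ w k k<l =
  lookup w (fromℕ< k<l) ,
  subst (λ m → take (suc m) w ≡ take m w ++ [ lookup w (fromℕ< k<l) ]) (toℕ-fromℕ< k<l) (Listₚ.take-suc w (fromℕ< k<l))

proposition3p3p2 : (w : Word) → 1 ≤ length w →
    (P : ℕ → Tableau) →
    (∀ k → k < length w → IsTableau (P k) × (take (suc k) w ∼ readWord (P k))) →
    IsOscillatingTableau (length w) (λ k → shape (P k))
proposition3p3p2 w _ P H = (λ k _ → shape-isYoungDiagram (P k)) , oscStep-at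
  where
  oscStep-at : ∀ k → suc k < length w → OscStep (shape (P k)) (shape (P (suc k)))
  oscStep-at k k+1<l =
    let x , take≡ = take-suc-++ w (suc k) k+1<l
        tab , iso = H k (<-trans (n<1+n k) k+1<l)
        tab' , iso' = H (suc k) k+1<l
    in oscStep-snoc (take (suc k) w) x tab tab' iso (subst (_∼ readWord (P (suc k))) take≡ iso')
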